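{- If $G$ is a looped simple graph with connected components $G_1,\dots,G_c$, then $M(IAS(G))=\bigoplus_{i=1}^c M(IAS(G_i))$. Moreover, $M(IAS(G_i))$ is a connected matroid unless $|V(G_i)|=1$, in which case $M(IAS(G_i))$ has two components, a loop and a pair of parallel non-loops.
   Context: A looped simple graph is a finite graph in which each vertex may carry at most one loop and distinct non-loop edges join distinct pairs of vertices. $A(G)$ is the adjacency matrix over $GF(2)$ (diagonal $1$ iff looped). $M(IAS(G))$ is the binary matroid represented by the columns of $(I\mid A(G)\mid I+A(G))$; its ground set $W(G)$ consists of three columns $v_\phi,v_\chi,v_\psi$ for each vertex $v$ (the columns of $v$ in $I$, $A(G)$, $I+A(G)$); $W(G_i)$ is identified with the subset of $W(G)$ of columns belonging to vertices of $G_i$. -}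

module Defs where

open import Data.Bool using (Bool; true; false; _∧_; _xor_)
open import Data.Nat using (ℕ; zero; suc; _+_)
open import Data.Fin using (Fin; zero; suc)
open import Data.Fin.Properties using () renaming (_≟_ to _≟F_)
open import Data.Product using (Σ; _×_; _,_; ∃; ∃-syntax)
open import Data.Sum using (_⊎_)
open import Relation.Nullary using (¬_)
open import Relation.Nullary.Decidable using (⌊_⌋)
open import Relation.Binary.PropositionalEquality using (_≡_; _≢_)
open import Function.Bundles using (_⇔_)

-- Looped simple graphs on vertex set Fin n.
-- adj u v = true iff u,v adjacent; adj v v = true iff v carries a loop.
-- Symmetry of a Bool-valued relation gives: at most one loop per vertex,
-- at most one edge between distinct vertices.

record LoopedSimpleGraph (n : ℕ) : Set where
  field
    adj     : Fin n → Fin n → Bool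
    adj-sym : ∀ u v → adj u v ≡ adj v u

open LoopedSimpleGraph public

-- Ground set W(G): three columns v_φ, v_χ, v_ψ per vertex v.

data ColKind : Set where
  φ χ ψ : ColKind

W : ℕ → Set
W n = Fin n × ColKind

WSet : ℕ → Set
WSet n = W n → Bool

VSet : ℕ → Set
VSet n = Fin n → Bool

-- GF(2) = Bool with xor / ∧.
-- The column of (v , k) in (I | A(G) | I + A(G)); entry in row u.
col : ∀ {n} → LoopedSimpleGraph n → W n → Fin n → Bool
col G (v , φ) u = ⌊ u ≟F v ⌋
col G (v , χ) u = adj G u v
col G (v , ψ) u = ⌊ u ≟F v ⌋ xor adj G u v

xorSum : ∀ {n} → (Fin n → Bool) → Bool
xorSum {zero}  f = false
xorSum {suc n} f = f zero xor xorSum (λ i → f (suc i))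

colSum : ∀ {n} → LoopedSimpleGraph n → WSet n → Fin n → Bool
colSum G T u = xorSum (λ v →
  ((T (v , φ) ∧ col G (v , φ) u) xor (T (v , χ) ∧ col G (v , χ) u))
    xor (T (v , ψ) ∧ col G (v , ψ) u))

_⊆_ : ∀ {n} → WSet n → WSet n → Set
T ⊆ S = ∀ e → T e ≡ true → S e ≡ true

WOf : ∀ {n} → VSet n → WSet n
WOf K (v , k) = K v

allV : ∀ {n} → VSet n
allV v = true

_∩W_ : ∀ {n} → WSet n → VSet n → WSet n
(S ∩W K) e = S e ∧ WOf K e

-- The binary matroid M(IAS(G[K])) of the induced subgraph G[K], on the
-- ground set W(K) ⊆ W(G).  Its columns are the columns of G restricted
-- to the rows in K (these are exactly the columns of (I | A(G[K]) | I+A(G[K]))).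
-- M(IAS(G)) itself is the case K = allV.

DependentIAS : ∀ {n} → LoopedSimpleGraph n → VSet n → WSet n → Set
DependentIAS G K S =
  ∃[ T ] (T ⊆ S × (∃[ e ] T e ≡ true) × (∀ u → K u ≡ true → colSum G T u ≡ false))

IndepIAS : ∀ {n} → LoopedSimpleGraph n → VSet n → WSet n → Set
IndepIAS G K S = S ⊆ WOf K × ¬ DependentIAS G K S

CircuitIAS : ∀ {n} → LoopedSimpleGraph n → VSet n → WSet n → Set
CircuitIAS G K C =
  C ⊆ WOf K × DependentIAS G K C ×
  (∀ T → T ⊆ C → (∃[ e ] (C e ≡ true × T e ≡ false)) → ¬ DependentIAS G K T)

IsConnectedIAS : ∀ {n} → LoopedSimpleGraph n → VSet n → Set
IsConnectedIAS G K =
  ∀ e f → WOf K e ≡ true → WOf K f ≡ true → e ≢ f →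
  ∃[ C ] (CircuitIAS G K C × C e ≡ true × C f ≡ true)

-- the relation whose classes are the components of the matroid
ConnRelIAS : ∀ {n} → LoopedSimpleGraph n → VSet n → W n → W n → Set
ConnRelIAS G K e f = e ≡ f ⊎ ∃[ C ] (CircuitIAS G K C × C e ≡ true × C f ≡ true)

eqK : ColKind → ColKind → Bool
eqK φ φ = true
eqK χ χ = true
eqK ψ ψ = true
eqK _ _ = false

eqW : ∀ {n} → W n → W n → Bool
eqW (v , k) (w , l) = ⌊ v ≟F w ⌋ ∧ eqK k l

single : ∀ {n} → W n → WSet n
single x e = eqW x e

pair : ∀ {n} → W n → W n → WSet n
pair x y e = eqW x e Data.Bool.∨ eqW y e

IsLoopIAS : ∀ {n} → LoopedSimpleGraph n → VSet n → W n → Set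
IsLoopIAS G K x = WOf K x ≡ true × DependentIAS G K (single x)

IsNonLoopIAS : ∀ {n} → LoopedSimpleGraph n → VSet n → W n → Set
IsNonLoopIAS G K x = WOf K x ≡ true × ¬ DependentIAS G K (single x)

LoopAndParallelPair : ∀ {n} → LoopedSimpleGraph n → VSet n → Set
LoopAndParallelPair G K =
  ∃[ x ] ∃[ y ] ∃[ z ]
    ( x ≢ y × x ≢ z × y ≢ z
    × (∀ e → WOf K e ≡ true → e ≡ x ⊎ e ≡ y ⊎ e ≡ z)
    × IsLoopIAS G K x
    × IsNonLoopIAS G K y × IsNonLoopIAS G K z
    × CircuitIAS G K (pair y z)
    × ¬ ConnRelIAS G K x y × ¬ ConnRelIAS G K x z × ConnRelIAS G K y z )

data Reachable {n} (G : LoopedSimpleGraph n) : Fin n → Fin n → Set where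
  here : ∀ {u} → Reachable G u u
  step : ∀ {u w v} → adj G u w ≡ true → Reachable G w v → Reachable G u v

IsComponent : ∀ {n} → LoopedSimpleGraph n → VSet n → Set
IsComponent G K =
  (∃[ v ] K v ≡ true) ×
  (∀ u v → K u ≡ true → (K v ≡ true ⇔ Reachable G u v))

card : ∀ {n} → VSet n → ℕ
card {zero}  K = 0
card {suc n} K = (Data.Bool.if K zero then 1 else 0) + card (λ i → K (suc i))

-- A column of a
-- vertex v vanishes in every row u outside the component of v (u ≠ v and u is not
-- adjacent to v), so a set of columns sums to zero iff its part in each component
-- does: this is the direct sum.
--
-- Inside a component K with at least two vertices there are two kinds of circuits.
-- For a vertex v with a neighbour w ≠ v, {v_φ, v_χ, v_ψ} is a circuit: v_ψ = v_φ + v_χ,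
-- and rows w and v show that no proper subset sums to zero.  For any vertex w,
-- {w_χ} ∪ {x_φ : x ~ w} is a circuit, since column w of A is the sum of the columns of
-- I at the neighbours of w.  Lying in a common circuit is transitive (by circuit
-- elimination), and along an edge v ~ w these circuits link v_φ, w_χ and w_φ; so
-- following walks, all of W(K) is linked and M(IAS(G[K])) is connected.
--
-- A single vertex v with loop indicator ℓ gives the 1 × 3 matrix (1 | ℓ | 1 + ℓ):
-- the zero entry is a loop and the two entries equal to 1 are parallel non-loops.

module Submission where

open import Defs
open import Data.Nat using (ℕ)
open import Data.Product using (_×_)
open import Relation.Binary.PropositionalEquality using (_≡_; _≢_)
open import Function.Bundles using (_⇔_)

open import Algebra.Bundles using (CommutativeRing; CommutativeMonoid)
open import Data.Bool using (Bool; true; false; not; _∧_; _∨_; _xor_; if_then_else_)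
open import Data.Bool.Properties
  using (_≟_; ¬-not; not-injective; ∨-comm; ∧-conicalˡ; ∧-conicalʳ; ∧-zeroʳ; ∧-identityʳ;
         ∧-distribˡ-xor; ∧-distribʳ-xor; xor-identityʳ; xor-same; xor-inverseʳ;
         xor-∧-commutativeRing)
open import Data.Empty using (⊥-elim)
open import Data.Fin using (Fin; zero; suc)
open import Data.Fin.Properties using (any?; all?; 0≢1+n; suc-injective) renaming (_≟_ to _≟F_)
open import Data.List using (List; []; _∷_; allFin; cartesianProduct)
open import Data.List.Membership.Propositional using (_∈_)
open import Data.List.Membership.Propositional.Properties using (∈-cartesianProduct⁺; ∈-allFin)
open import Data.List.Relation.Unary.Any using (here; there)
open import Data.Nat using (zero; suc; _≤_; _<_; z≤n; s≤s)
open import Data.Nat.Induction using (<-wellFounded)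
open import Data.Nat.Properties using (≤-trans; m≤n+m; m≤n⇒m≤1+n; m<n⇒m<1+n)
open import Data.Product using (_,_; proj₁; proj₂; ∃; ∃-syntax)
open import Data.Sum using (_⊎_; inj₁; inj₂; [_,_]′)
open import Function.Base using (_∘_; id; case_of_)
open import Function.Bundles using (Equivalence; mk⇔)
open import Induction.WellFounded using (Acc; acc)
open import Relation.Nullary using (¬_; Dec; yes; no)
open import Relation.Nullary.Decidable
  using (⌊_⌋; ¬?; decidable-stable; map′; _×-dec_; _⊎-dec_; _→-dec_)
open import Relation.Nullary.Decidable.Core using (¬¬-excluded-middle)
open import Relation.Binary.PropositionalEquality
  using (refl; sym; trans; cong; cong₂; subst; _≗_; module ≡-Reasoning)

open CommutativeRing xor-∧-commutativeRing using (+-commutativeMonoid)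
open import Algebra.Properties.CommutativeSemigroup
  (CommutativeMonoid.commutativeSemigroup +-commutativeMonoid) using (interchange)

≡true⇒≢false : ∀ {b} → b ≡ true → b ≢ false
≡true⇒≢false refl ()

xor≡false⇒≡ : ∀ {a b} → a xor b ≡ false → a ≡ b
xor≡false⇒≡ {false} refl = refl
xor≡false⇒≡ {true} {true} _ = refl

dot₃-xor : ∀ a b c a′ b′ c′ p q r →
  (((a xor a′) ∧ p) xor ((b xor b′) ∧ q)) xor ((c xor c′) ∧ r)
    ≡ (((a ∧ p) xor (b ∧ q)) xor (c ∧ r)) xor (((a′ ∧ p) xor (b′ ∧ q)) xor (c′ ∧ r))
dot₃-xor a b c a′ b′ c′ p q r
  rewrite ∧-distribʳ-xor p a a′ | ∧-distribʳ-xor q b b′ | ∧-distribʳ-xor r c c′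
        | interchange (a ∧ p) (a′ ∧ p) (b ∧ q) (b′ ∧ q)
  = interchange ((a ∧ p) xor (b ∧ q)) ((a′ ∧ p) xor (b′ ∧ q)) (c ∧ r) (c′ ∧ r)

⌊⌋⇔ : ∀ {P : Set} (P? : Dec P) → ⌊ P? ⌋ ≡ true ⇔ P
⌊⌋⇔ (yes p) = mk⇔ (λ _ → p) (λ _ → refl)
⌊⌋⇔ (no ¬p) = mk⇔ (λ ()) (⊥-elim ∘ ¬p)

⌊≟⌋-refl : ∀ {n} (v : Fin n) → ⌊ v ≟F v ⌋ ≡ true
⌊≟⌋-refl v = Equivalence.from (⌊⌋⇔ (v ≟F v)) refl

⌊≟⌋⇒≡ : ∀ {n} {u v : Fin n} → ⌊ u ≟F v ⌋ ≡ true → u ≡ v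
⌊≟⌋⇒≡ {u = u} {v} = Equivalence.to (⌊⌋⇔ (u ≟F v))

⌊≟⌋-≢ : ∀ {n} {u v : Fin n} → u ≢ v → ⌊ u ≟F v ⌋ ≡ false
⌊≟⌋-≢ u≢v = ¬-not (u≢v ∘ ⌊≟⌋⇒≡)

xorSum-cong : ∀ {n} {f g : Fin n → Bool} → f ≗ g → xorSum f ≡ xorSum g
xorSum-cong {zero}  f≗g = refl
xorSum-cong {suc n} f≗g = cong₂ _xor_ (f≗g zero) (xorSum-cong (f≗g ∘ suc))

xorSum-xor : ∀ {n} (f g : Fin n → Bool) → xorSum (λ i → f i xor g i) ≡ xorSum f xor xorSum g
xorSum-xor {zero}  f g = refl
xorSum-xor {suc n} f g =
  trans (cong ((f zero xor g zero) xor_) (xorSum-xor (f ∘ suc) (g ∘ suc)))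
        (interchange (f zero) (g zero) (xorSum (f ∘ suc)) (xorSum (g ∘ suc)))

xorSum-false : ∀ {n} (f : Fin n → Bool) → (∀ i → f i ≡ false) → xorSum f ≡ false
xorSum-false {zero}  f f≡false = refl
xorSum-false {suc n} f f≡false
  rewrite f≡false zero = xorSum-false (f ∘ suc) (f≡false ∘ suc)

xorSum-single : ∀ {n} (f : Fin n → Bool) i → (∀ j → j ≢ i → f j ≡ false) → xorSum f ≡ f i
xorSum-single {suc n} f zero rest =
  trans (cong (f zero xor_) (xorSum-false (f ∘ suc) λ j → rest (suc j) λ ())) (xor-identityʳ _)
xorSum-single {suc n} f (suc i) rest
  rewrite rest zero (λ ()) =
  xorSum-single (f ∘ suc) i λ j j≢i → rest (suc j) (j≢i ∘ suc-injective)

NonEmpty : ∀ {n} → WSet n → Set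
NonEmpty T = ∃[ e ] T e ≡ true

⊆-refl : ∀ {n} {T : WSet n} → T ⊆ T
⊆-refl e Te = Te

⊆-trans : ∀ {n} {S T U : WSet n} → S ⊆ T → T ⊆ U → S ⊆ U
⊆-trans S⊆T T⊆U e = T⊆U e ∘ S⊆T e

⊆-false : ∀ {n} {T Z : WSet n} → T ⊆ Z → ∀ e → Z e ≡ false → T e ≡ false
⊆-false T⊆Z e Ze = ¬-not λ Te → ≡true⇒≢false (T⊆Z e Te) Ze

⊆-antisym : ∀ {n} {T Z : WSet n} → T ⊆ Z → Z ⊆ T → T ≗ Z
⊆-antisym {T = T} T⊆Z Z⊆T x with T x in Tx
... | true  = sym (T⊆Z x Tx)
... | false = sym (⊆-false Z⊆T x Tx)

_⊈_ : ∀ {n} → WSet n → WSet n → Set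
T ⊈ Z = ∃[ x ] (T x ≡ true × Z x ≡ false)

¬⊈⇒⊆ : ∀ {n} {T Z : WSet n} → ¬ T ⊈ Z → T ⊆ Z
¬⊈⇒⊆ ¬T⊈Z x Tx = ¬-not λ Zx → ¬T⊈Z (x , Tx , Zx)

_∩_ _−_ _Δ_ : ∀ {n} → WSet n → WSet n → WSet n
(A ∩ B) e = A e ∧ B e
(A − B) e = A e ∧ not (B e)
(A Δ B) e = A e xor B e

Δ-⊆ˡ : ∀ {n} {T Z : WSet n} → T ⊆ Z → (Z Δ T) ⊆ Z
Δ-⊆ˡ {T = T} {Z} T⊆Z x h with T x in Tx
... | true  = T⊆Z x Tx
... | false = trans (sym (xor-identityʳ (Z x))) h

Δ-⊆ : ∀ {n} {A B U : WSet n} → A ⊆ U → B ⊆ U → (A Δ B) ⊆ U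
Δ-⊆ {A = A} A⊆U B⊆U x h with A x in Ax
... | true  = A⊆U x Ax
... | false = B⊆U x h

⊆Δ⇒∈ʳ : ∀ {n} {D A B : WSet n} {x} → D ⊆ (A Δ B) → D x ≡ true → A x ≡ false → B x ≡ true
⊆Δ⇒∈ʳ {A = A} {B} {x} D⊆AΔB Dx Ax = subst (λ b → b xor B x ≡ true) Ax (D⊆AΔB x Dx)

⊆Δ-− : ∀ {n} {D A B : WSet n} → D ⊆ (A Δ B) → (D − B) ⊆ (A − B)
⊆Δ-− {D = D} {A} {B} D⊆AΔB x h with D x in Dx | B x in Bx
... | true  | false = trans (∧-identityʳ (A x))
  (trans (sym (xor-identityʳ (A x))) (subst (λ b → A x xor b ≡ true) Bx (D⊆AΔB x Dx)))

⊆Δ-Δ : ∀ {n} {D A B : WSet n} → D ⊆ (A Δ B) → (A − B) ⊆ D → (D Δ A) ⊆ B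
⊆Δ-Δ {D = D} {A} {B} D⊆AΔB A−B⊆D x h with D x in Dx | A x in Ax
... | true  | false = ⊆Δ⇒∈ʳ {A = A} {B} D⊆AΔB Dx Ax
... | false | true  with B x in Bx
...   | true  = refl
...   | false = ⊥-elim (≡true⇒≢false (A−B⊆D x (cong₂ (λ a b → a ∧ not b) Ax Bx)) Dx)

∩-⊆ˡ : ∀ {n} {A B : WSet n} → (A ∩ B) ⊆ A
∩-⊆ˡ e = ∧-conicalˡ _ _

∩-⊆ʳ : ∀ {n} {A B : WSet n} → (A ∩ B) ⊆ B
∩-⊆ʳ e = ∧-conicalʳ _ _

∩-monoˡ : ∀ {n} {A B C : WSet n} → A ⊆ B → (A ∩ C) ⊆ (B ∩ C)
∩-monoˡ A⊆B e h = cong₂ _∧_ (A⊆B e (∧-conicalˡ _ _ h)) (∧-conicalʳ _ _ h)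

∩Δ− : ∀ {n} (T A : WSet n) → T ≗ ((T ∩ A) Δ (T − A))
∩Δ− T A e with T e
... | true  = sym (xor-inverseʳ (A e))
... | false = refl

eqK⇒≡ : ∀ {k l} → eqK k l ≡ true → k ≡ l
eqK⇒≡ {φ} {φ} _ = refl
eqK⇒≡ {χ} {χ} _ = refl
eqK⇒≡ {ψ} {ψ} _ = refl

eqK-refl : ∀ k → eqK k k ≡ true
eqK-refl φ = refl
eqK-refl χ = refl
eqK-refl ψ = refl

eqW⇒≡ : ∀ {n} (x e : W n) → eqW x e ≡ true → x ≡ e
eqW⇒≡ (v , k) (w , l) h
  with ⌊≟⌋⇒≡ {u = v} {w} (∧-conicalˡ _ _ h) | eqK⇒≡ {k} {l} (∧-conicalʳ _ _ h)
... | refl | refl = refl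

eqW-refl : ∀ {n} (x : W n) → eqW x x ≡ true
eqW-refl (v , k) = cong₂ _∧_ (⌊≟⌋-refl v) (eqK-refl k)

single-member : ∀ {n} {T : WSet n} x → T x ≡ true → single x ⊆ T
single-member {T = T} x Tx e x≟e = subst (λ y → T y ≡ true) (eqW⇒≡ x e x≟e) Tx

⊆single⇒⊇ : ∀ {n} {T : WSet n} x → T ⊆ single x → NonEmpty T → single x ⊆ T
⊆single⇒⊇ {T = T} x T⊆x (e , Te) =
  single-member x (subst (λ y → T y ≡ true) (sym (eqW⇒≡ x e (T⊆x e Te))) Te)

pair-⊆ : ∀ {n} {T : WSet n} x y → T x ≡ true → T y ≡ true → pair x y ⊆ T
pair-⊆ x y Tx Ty e h with eqW x e in x≟e
... | true  = single-member x Tx e x≟e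
... | false = single-member y Ty e h

⊆pair⇒⊆single : ∀ {n} {T : WSet n} x y → T ⊆ pair x y → T x ≡ false → T ⊆ single y
⊆pair⇒⊆single {T = T} x y T⊆xy Tx e Te with eqW x e in x≟e
... | true  = ⊥-elim (≡true⇒≢false (subst (λ z → T z ≡ true) (sym (eqW⇒≡ x e x≟e)) Te) Tx)
... | false = subst (λ b → b ∨ eqW y e ≡ true) x≟e (T⊆xy e Te)

pair-comm : ∀ {n} (x y : W n) → pair x y ≗ pair y x
pair-comm x y e = ∨-comm (eqW x e) (eqW y e)

pair-∋ˡ : ∀ {n} (x y : W n) → pair x y x ≡ true
pair-∋ˡ x y = cong (_∨ eqW y x) (eqW-refl x)

pair-∋ʳ : ∀ {n} (x y : W n) → pair x y y ≡ true
pair-∋ʳ x y = trans (pair-comm x y y) (pair-∋ˡ y x)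

pair≗Δ : ∀ {n} {x y : W n} → x ≢ y → pair x y ≗ (single x Δ single y)
pair≗Δ {x = x} {y} x≢y e with eqW x e in x≟e | eqW y e in y≟e
... | true  | true  = ⊥-elim (x≢y (trans (eqW⇒≡ x e x≟e) (sym (eqW⇒≡ y e y≟e))))
... | true  | false = refl
... | false | true  = refl
... | false | false = refl

∀Kind? : {P : ColKind → Set} → (∀ k → Dec (P k)) → Dec (∀ k → P k)
∀Kind? P? = map′ (λ { (p , q , r) φ → p ; (p , q , r) χ → q ; (p , q , r) ψ → r })
                 (λ h → h φ , h χ , h ψ) (P? φ ×-dec P? χ ×-dec P? ψ)

∃Kind? : {P : ColKind → Set} → (∀ k → Dec (P k)) → Dec (∃ P)
∃Kind? P? = map′ (λ { (inj₁ p) → φ , p ; (inj₂ (inj₁ p)) → χ , p ; (inj₂ (inj₂ p)) → ψ , p })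
                 (λ { (φ , p) → inj₁ p ; (χ , p) → inj₂ (inj₁ p) ; (ψ , p) → inj₂ (inj₂ p) })
                 (P? φ ⊎-dec P? χ ⊎-dec P? ψ)

∀W? : ∀ {n} {P : W n → Set} → (∀ e → Dec (P e)) → Dec (∀ e → P e)
∀W? P? = map′ (λ h (v , k) → h v k) (λ h v k → h (v , k)) (all? λ v → ∀Kind? λ k → P? (v , k))

∃W? : ∀ {n} {P : W n → Set} → (∀ e → Dec (P e)) → Dec (∃ P)
∃W? P? = map′ (λ (v , k , p) → (v , k) , p) (λ ((v , k) , p) → v , k , p)
              (any? λ v → ∃Kind? λ k → P? (v , k))

_⊆?_ : ∀ {n} (T Z : WSet n) → Dec (T ⊆ Z)
T ⊆? Z = ∀W? λ e → (T e ≟ true) →-dec (Z e ≟ true)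

_⊈?_ : ∀ {n} (T Z : WSet n) → Dec (T ⊈ Z)
T ⊈? Z = ∃W? λ x → (T x ≟ true) ×-dec (Z x ≟ false)

nonEmpty? : ∀ {n} (T : WSet n) → Dec (NonEmpty T)
nonEmpty? T = ∃W? λ e → T e ≟ true

∃Bool? : {P : Bool → Set} → (∀ b → Dec (P b)) → Dec (∃ P)
∃Bool? P? = map′ (λ { (inj₁ p) → true , p ; (inj₂ p) → false , p })
                 (λ { (true , p) → inj₁ p ; (false , p) → inj₂ p }) (P? true ⊎-dec P? false)

extend : ∀ {n} → Bool → Bool → Bool → WSet n → WSet (suc n)
extend a b c T (zero  , φ) = a
extend a b c T (zero  , χ) = b
extend a b c T (zero  , ψ) = c
extend a b c T (suc i , k) = T (i , k)

extend-cong : ∀ {n} a b c {T T′ : WSet n} → T ≗ T′ → extend a b c T ≗ extend a b c T′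
extend-cong a b c T≗T′ (zero  , φ) = refl
extend-cong a b c T≗T′ (zero  , χ) = refl
extend-cong a b c T≗T′ (zero  , ψ) = refl
extend-cong a b c T≗T′ (suc i , k) = T≗T′ (i , k)

extend-head-tail : ∀ {n} (T : WSet (suc n)) →
  T ≗ extend (T (zero , φ)) (T (zero , χ)) (T (zero , ψ)) (λ (i , k) → T (suc i , k))
extend-head-tail T (zero  , φ) = refl
extend-head-tail T (zero  , χ) = refl
extend-head-tail T (zero  , ψ) = refl
extend-head-tail T (suc i , k) = refl

-- By enumerating the 8ⁿ subsets; P must respect ≗ as WSet n is a function type.
∃WSet? : ∀ {n} {P : WSet n → Set} → (∀ {T T′} → T ≗ T′ → P T → P T′) →
  (∀ T → Dec (P T)) → Dec (∃ P)
∃WSet? {zero} resp P? =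
  map′ (λ p → _ , p) (λ (T , p) → resp (λ { (() , _) }) p) (P? λ _ → false)
∃WSet? {suc n} resp P? =
  map′ (λ (a , b , c , T , p) → extend a b c T , p)
       (λ (T , p) → _ , _ , _ , _ , resp (extend-head-tail T) p)
       (∃Bool? λ a → ∃Bool? λ b → ∃Bool? λ c →
          ∃WSet? (resp ∘ extend-cong a b c) (P? ∘ extend a b c))

countIn : ∀ {A : Set} → List A → (A → Bool) → ℕ
countIn []       T = 0
countIn (x ∷ xs) T = if T x then suc (countIn xs T) else countIn xs T

countIn-mono : ∀ {A : Set} (xs : List A) {T Z : A → Bool} →
  (∀ x → T x ≡ true → Z x ≡ true) → countIn xs T ≤ countIn xs Z
countIn-mono []       T⊆Z = z≤n
countIn-mono (x ∷ xs) {T} {Z} T⊆Z with T x in Tx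
... | true rewrite T⊆Z x Tx = s≤s (countIn-mono xs T⊆Z)
... | false with Z x
...   | true  = m≤n⇒m≤1+n (countIn-mono xs T⊆Z)
...   | false = countIn-mono xs T⊆Z

countIn-mono-< : ∀ {A : Set} (xs : List A) {T Z : A → Bool} {y} →
  (∀ x → T x ≡ true → Z x ≡ true) → y ∈ xs → Z y ≡ true → T y ≡ false →
  countIn xs T < countIn xs Z
countIn-mono-< (x ∷ xs) T⊆Z (here refl) Zy Ty rewrite Zy | Ty = s≤s (countIn-mono xs T⊆Z)
countIn-mono-< (x ∷ xs) {T} {Z} T⊆Z (there y∈xs) Zy Ty with T x in Tx
... | true rewrite T⊆Z x Tx = s≤s (countIn-mono-< xs T⊆Z y∈xs Zy Ty)
... | false with Z x
...   | true  = m<n⇒m<1+n (countIn-mono-< xs T⊆Z y∈xs Zy Ty)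
...   | false = countIn-mono-< xs T⊆Z y∈xs Zy Ty

enumW : ∀ n → List (W n)
enumW n = cartesianProduct (allFin n) (φ ∷ χ ∷ ψ ∷ [])

∈-enumW : ∀ {n} (e : W n) → e ∈ enumW n
∈-enumW (v , φ) = ∈-cartesianProduct⁺ (∈-allFin v) (here refl)
∈-enumW (v , χ) = ∈-cartesianProduct⁺ (∈-allFin v) (there (here refl))
∈-enumW (v , ψ) = ∈-cartesianProduct⁺ (∈-allFin v) (there (there (here refl)))

size : ∀ {n} → WSet n → ℕ
size {n} = countIn (enumW n)

size-< : ∀ {n} {T Z : WSet n} → T ⊆ Z → Z ⊈ T → size T < size Z
size-< T⊆Z (x , Zx , Tx) = countIn-mono-< _ T⊆Z (∈-enumW x) Zx Tx

columnsAt : ∀ {n} → LoopedSimpleGraph n → WSet n → Fin n → Fin n → Bool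
columnsAt G T u v =
  ((T (v , φ) ∧ col G (v , φ) u) xor (T (v , χ) ∧ col G (v , χ) u))
    xor (T (v , ψ) ∧ col G (v , ψ) u)

module _ {n} (G : LoopedSimpleGraph n) where

  colSum-cong : ∀ {T T′} → T ≗ T′ → ∀ u → colSum G T u ≡ colSum G T′ u
  colSum-cong T≗T′ u = xorSum-cong λ v →
    cong₂ _xor_ (cong₂ _xor_ (cong (_∧ _) (T≗T′ (v , φ))) (cong (_∧ _) (T≗T′ (v , χ))))
                (cong (_∧ _) (T≗T′ (v , ψ)))

  colSum-Δ : ∀ T T′ u → colSum G (T Δ T′) u ≡ colSum G T u xor colSum G T′ u
  colSum-Δ T T′ u =
    trans (xorSum-cong λ v → dot₃-xor (T (v , φ)) (T (v , χ)) (T (v , ψ))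
                                     (T′ (v , φ)) (T′ (v , χ)) (T′ (v , ψ)) _ _ _)
          (xorSum-xor (columnsAt G T u) (columnsAt G T′ u))

  col-false : ∀ {u v} → u ≢ v → adj G u v ≡ false → ∀ k → col G (v , k) u ≡ false
  col-false {u} {v} u≢v ¬uv φ = ⌊≟⌋-≢ u≢v
  col-false {u} {v} u≢v ¬uv χ = ¬uv
  col-false {u} {v} u≢v ¬uv ψ rewrite ⌊≟⌋-≢ u≢v | ¬uv = refl

  columnsAt-false : ∀ T u v → (∀ k → T (v , k) ≡ true → col G (v , k) u ≡ false) →
    columnsAt G T u v ≡ false
  columnsAt-false T u v h = cong₂ _xor_ (cong₂ _xor_ (summand φ) (summand χ)) (summand ψ)
    where
    summand : ∀ k → T (v , k) ∧ col G (v , k) u ≡ false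
    summand k with T (v , k) in Tvk
    ... | false = refl
    ... | true  = h k Tvk

  colSum-apart : ∀ T u → (∀ v k → T (v , k) ≡ true → u ≢ v × adj G u v ≡ false) →
    colSum G T u ≡ false
  colSum-apart T u apart = xorSum-false (columnsAt G T u) λ v →
    columnsAt-false T u v λ k Tvk → col-false (proj₁ (apart v k Tvk)) (proj₂ (apart v k Tvk)) k

  colSum-supportedAt : ∀ T v → (∀ w k → T (w , k) ≡ true → w ≡ v) →
    ∀ u → colSum G T u ≡ columnsAt G T u v
  colSum-supportedAt T v supp u = xorSum-single (columnsAt G T u) v λ w w≢v →
    columnsAt-false T u w λ k Twk → ⊥-elim (w≢v (supp w k Twk))

  columnsAt-offDiagonal : ∀ T {u v} → u ≢ v →
    columnsAt G T u v ≡ (T (v , χ) xor T (v , ψ)) ∧ adj G u v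
  columnsAt-offDiagonal T {u} {v} u≢v
    rewrite ⌊≟⌋-≢ u≢v | ∧-zeroʳ (T (v , φ)) =
    sym (∧-distribʳ-xor (adj G u v) (T (v , χ)) (T (v , ψ)))

  columnsAt-diagonal : ∀ T v →
    columnsAt G T v v ≡ (T (v , φ) xor T (v , ψ)) xor ((T (v , χ) xor T (v , ψ)) ∧ adj G v v)
  columnsAt-diagonal T v rewrite ⌊≟⌋-refl v = begin
    ((a ∧ true) xor (b ∧ ℓ)) xor (c ∧ (true xor ℓ))
      ≡⟨ cong₂ (λ x y → (x xor (b ∧ ℓ)) xor y) (∧-identityʳ a) (∧-distribˡ-xor c true ℓ) ⟩
    (a xor (b ∧ ℓ)) xor ((c ∧ true) xor (c ∧ ℓ))
      ≡⟨ cong (λ x → (a xor (b ∧ ℓ)) xor (x xor (c ∧ ℓ))) (∧-identityʳ c) ⟩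
    (a xor (b ∧ ℓ)) xor (c xor (c ∧ ℓ))
      ≡⟨ interchange a (b ∧ ℓ) c (c ∧ ℓ) ⟩
    (a xor c) xor ((b ∧ ℓ) xor (c ∧ ℓ))
      ≡⟨ cong ((a xor c) xor_) (∧-distribʳ-xor ℓ b c) ⟨
    (a xor c) xor ((b xor c) ∧ ℓ)
      ∎
    where
    open ≡-Reasoning
    a = T (v , φ)
    b = T (v , χ)
    c = T (v , ψ)
    ℓ = adj G v v

IsCycle : ∀ {n} → LoopedSimpleGraph n → VSet n → WSet n → Set
IsCycle G K T = ∀ u → K u ≡ true → colSum G T u ≡ false

module _ {n} (G : LoopedSimpleGraph n) (K : VSet n) where

  isCycle-Δ : ∀ {T T′} → IsCycle G K T → IsCycle G K T′ → IsCycle G K (T Δ T′)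
  isCycle-Δ {T} {T′} cyc cyc′ u Ku rewrite colSum-Δ G T T′ u | cyc u Ku | cyc′ u Ku = refl

  isCycle-resp : ∀ {T T′} → T ≗ T′ → IsCycle G K T → IsCycle G K T′
  isCycle-resp T≗T′ cyc u Ku = trans (sym (colSum-cong G T≗T′ u)) (cyc u Ku)

  isCycle? : ∀ T → Dec (IsCycle G K T)
  isCycle? T = all? λ u → (K u ≟ true) →-dec (colSum G T u ≟ false)

  circuit-intro : ∀ {C} → C ⊆ WOf K → NonEmpty C → IsCycle G K C →
    (∀ {T} → T ⊆ C → NonEmpty T → IsCycle G K T → C ⊆ T) → CircuitIAS G K C
  circuit-intro C⊆K ne cyc min = C⊆K , (_ , ⊆-refl , ne , cyc) , λ where
    T T⊆C (x , Cx , Tx) (T′ , T′⊆T , ne′ , cyc′) →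
      ≡true⇒≢false (min (⊆-trans T′⊆T T⊆C) ne′ cyc′ x Cx) (⊆-false T′⊆T x Tx)

  circuit-minimal : ∀ {C T} → CircuitIAS G K C → T ⊆ C → NonEmpty T → IsCycle G K T → C ⊆ T
  circuit-minimal (_ , _ , min) T⊆C ne cyc =
    ¬⊈⇒⊆ λ C⊈T → min _ T⊆C C⊈T (_ , ⊆-refl , ne , cyc)

  circuit-isCycle : ∀ {C} → CircuitIAS G K C → IsCycle G K C
  circuit-isCycle c@(_ , (T , T⊆C , ne , cyc) , _) =
    isCycle-resp (⊆-antisym T⊆C (circuit-minimal c T⊆C ne cyc)) cyc

  ProperSubcycle : WSet n → WSet n → Set
  ProperSubcycle Z T = T ⊆ Z × Z ⊈ T × NonEmpty T × IsCycle G K T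

  properSubcycle? : ∀ Z → Dec (∃ (ProperSubcycle Z))
  properSubcycle? Z =
    ∃WSet? resp λ T → (T ⊆? Z) ×-dec (Z ⊈? T) ×-dec nonEmpty? T ×-dec isCycle? T
    where
    resp : ∀ {T T′} → T ≗ T′ → ProperSubcycle Z T → ProperSubcycle Z T′
    resp T≗T′ (T⊆Z , (x , Zx , Tx) , (e , Te) , cyc) =
      (λ y T′y → T⊆Z y (trans (T≗T′ y) T′y)) , (x , Zx , trans (sym (T≗T′ x)) Tx) ,
      (e , trans (sym (T≗T′ e)) Te) , isCycle-resp T≗T′ cyc

  CircuitWithin : WSet n → W n → Set
  CircuitWithin Z e = ∃[ C ] (CircuitIAS G K C × C ⊆ Z × C e ≡ true)

  circuitWithin-mono : ∀ {T Z e} → T ⊆ Z → CircuitWithin T e → CircuitWithin Z e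
  circuitWithin-mono T⊆Z (C , c , C⊆T , Ce) = C , c , ⊆-trans C⊆T T⊆Z , Ce

  -- Descend to a proper subcycle T: e lies in T or in the smaller cycle Z Δ T.
  cycle-contains-circuit : ∀ {Z e} → Acc _<_ (size Z) →
    Z ⊆ WOf K → IsCycle G K Z → Z e ≡ true → CircuitWithin Z e
  cycle-contains-circuit {Z} {e} (acc smaller) Z⊆K cyc Ze with properSubcycle? Z
  ... | no ∄T = Z , circuit-intro Z⊆K (e , Ze) cyc minimal , ⊆-refl , Ze
    where
    minimal : ∀ {T} → T ⊆ Z → NonEmpty T → IsCycle G K T → Z ⊆ T
    minimal T⊆Z ne cycT = ¬⊈⇒⊆ λ Z⊈T → ∄T (_ , T⊆Z , Z⊈T , ne , cycT)
  ... | yes (T , T⊆Z , Z⊈T , (y , Ty) , cycT) with T e in Te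
  ...   | true  = circuitWithin-mono T⊆Z
    (cycle-contains-circuit (smaller (size-< T⊆Z Z⊈T)) (⊆-trans T⊆Z Z⊆K) cycT Te)
  ...   | false = circuitWithin-mono ZΔT⊆Z
    (cycle-contains-circuit (smaller (size-< ZΔT⊆Z Z⊈ZΔT)) (⊆-trans ZΔT⊆Z Z⊆K)
      (isCycle-Δ {Z} {T} cyc cycT) (cong₂ _xor_ Ze Te))
    where
    ZΔT⊆Z : (Z Δ T) ⊆ Z
    ZΔT⊆Z = Δ-⊆ˡ T⊆Z
    Z⊈ZΔT : Z ⊈ (Z Δ T)
    Z⊈ZΔT = y , T⊆Z y Ty , cong₂ _xor_ (T⊆Z y Ty) Ty

  -- If e ∈ C₂ or g ∈ C₁ we are done.  Otherwise take a circuit D ∋ e in the cycle C₁ Δ C₂,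
  -- with g ∉ D.  Minimality of C₁ (f ∉ D) gives some f′ ∈ D − C₁, so f′ ∈ C₂; and D misses
  -- some x ∈ C₁ − C₂, since otherwise D Δ C₁ ⊊ C₂ would be a cycle containing f.
  -- Recurse on D and C₂.
  common-circuit : ∀ {C₁ C₂ e f g} → Acc _<_ (size (C₁ − C₂)) →
    CircuitIAS G K C₁ → CircuitIAS G K C₂ →
    C₁ e ≡ true → C₁ f ≡ true → C₂ f ≡ true → C₂ g ≡ true →
    ∃[ C ] (CircuitIAS G K C × C e ≡ true × C g ≡ true)
  common-circuit {C₁} {C₂} {e} {f} {g} (acc smaller) c₁ c₂ C₁e C₁f C₂f C₂g
    with C₂ e in C₂e | C₁ g in C₁g
  ... | true  | _    = C₂ , c₂ , C₂e , C₂g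
  ... | false | true = C₁ , c₁ , C₁e , C₁g
  ... | false | false
    with cycle-contains-circuit (<-wellFounded _) (Δ-⊆ (proj₁ c₁) (proj₁ c₂))
           (isCycle-Δ {C₁} {C₂} (circuit-isCycle c₁) (circuit-isCycle c₂))
           (cong₂ _xor_ C₁e C₂e)
  ... | D , d , D⊆C₁ΔC₂ , De with D g in Dg
  ...   | true = D , d , De , Dg
  ...   | false with D ⊈? C₁
  ...     | no ¬D⊈C₁ = ⊥-elim (≡true⇒≢false
    (circuit-minimal c₁ (¬⊈⇒⊆ ¬D⊈C₁) (e , De) (circuit-isCycle d) f C₁f)
    (⊆-false D⊆C₁ΔC₂ f (cong₂ _xor_ C₁f C₂f)))
  ...     | yes (f′ , Df′ , C₁f′) with (C₁ − C₂) ⊈? D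
  ...       | no ¬C₁−C₂⊈D = ⊥-elim (≡true⇒≢false
    (circuit-minimal c₂ (⊆Δ-Δ D⊆C₁ΔC₂ (¬⊈⇒⊆ ¬C₁−C₂⊈D))
       (f , cong₂ _xor_ (⊆-false D⊆C₁ΔC₂ f (cong₂ _xor_ C₁f C₂f)) C₁f)
       (isCycle-Δ {D} {C₁} (circuit-isCycle d) (circuit-isCycle c₁)) g C₂g)
    (cong₂ _xor_ Dg C₁g))
  ...       | yes (x , C₁−C₂x , Dx) =
    common-circuit (smaller (size-< (⊆Δ-− D⊆C₁ΔC₂) (x , C₁−C₂x , cong (_∧ _) Dx)))
      d c₂ De Df′ (⊆Δ⇒∈ʳ {A = C₁} {C₂} D⊆C₁ΔC₂ Df′ C₁f′) C₂g

  connRel-trans : ∀ {e f g} → ConnRelIAS G K e f → ConnRelIAS G K f g → ConnRelIAS G K e g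
  connRel-trans (inj₁ refl) f~g = f~g
  connRel-trans e~f (inj₁ refl) = e~f
  connRel-trans (inj₂ (C₁ , c₁ , C₁e , C₁f)) (inj₂ (C₂ , c₂ , C₂f , C₂g)) =
    inj₂ (common-circuit (<-wellFounded _) c₁ c₂ C₁e C₁f C₂f C₂g)

  isLoop-intro : ∀ {x} → WOf K x ≡ true → IsCycle G K (single x) → IsLoopIAS G K x
  isLoop-intro {x} Kx cyc = Kx , single x , ⊆-refl , (x , eqW-refl x) , cyc

  isNonLoop-intro : ∀ {x} → WOf K x ≡ true →
    ∀ u → K u ≡ true → colSum G (single x) u ≡ true → IsNonLoopIAS G K x
  isNonLoop-intro {x} Kx u Ku colx≢0 = Kx , λ (T , T⊆x , ne , cyc) →
    ≡true⇒≢false colx≢0 (isCycle-resp (⊆-antisym T⊆x (⊆single⇒⊇ x T⊆x ne)) cyc u Ku)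

  parallel-circuit : ∀ {x y} → x ≢ y → IsNonLoopIAS G K x → IsNonLoopIAS G K y →
    (∀ u → K u ≡ true → colSum G (single x) u ≡ colSum G (single y) u) →
    CircuitIAS G K (pair x y)
  parallel-circuit {x} {y} x≢y (Kx , x-indep) (Ky , y-indep) same =
    circuit-intro pair⊆K (x , pair-∋ˡ x y) cyc minimal
    where
    pair⊆K : pair x y ⊆ WOf K
    pair⊆K = pair-⊆ x y Kx Ky
    cyc : IsCycle G K (pair x y)
    cyc u Ku = begin
      colSum G (pair x y) u                            ≡⟨ colSum-cong G (pair≗Δ x≢y) u ⟩
      colSum G (single x Δ single y) u                 ≡⟨ colSum-Δ G (single x) (single y) u ⟩
      colSum G (single x) u xor colSum G (single y) u  ≡⟨ cong (_xor _) (same u Ku) ⟩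
      colSum G (single y) u xor colSum G (single y) u  ≡⟨ xor-same (colSum G (single y) u) ⟩
      false                                            ∎
      where open ≡-Reasoning
    minimal : ∀ {T} → T ⊆ pair x y → NonEmpty T → IsCycle G K T → pair x y ⊆ T
    minimal {T} T⊆xy ne cycT with T x in Tx | T y in Ty
    ... | true  | true  = pair-⊆ x y Tx Ty
    ... | false | _     = ⊥-elim (y-indep (T , ⊆pair⇒⊆single x y T⊆xy Tx , ne , cycT))
    ... | true  | false = ⊥-elim (x-indep (T , T⊆x , ne , cycT))
      where
      T⊆x : T ⊆ single x
      T⊆x = ⊆pair⇒⊆single y x (λ e Te → trans (pair-comm y x e) (T⊆xy e Te)) Ty

  loop-isolated : ∀ {x y} → IsLoopIAS G K x → x ≢ y → ¬ ConnRelIAS G K x y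
  loop-isolated _ x≢y (inj₁ x≡y) = x≢y x≡y
  loop-isolated (_ , T , T⊆x , ne , cyc) x≢y (inj₂ (C , c , Cx , Cy)) =
    x≢y (eqW⇒≡ _ _ (T⊆x _ (circuit-minimal c (⊆-trans T⊆x (single-member _ Cx)) ne cyc _ Cy)))

  loopAndParallelPair : ∀ {x y z} → x ≢ y → x ≢ z → y ≢ z →
    (∀ e → WOf K e ≡ true → e ≡ x ⊎ e ≡ y ⊎ e ≡ z) →
    IsLoopIAS G K x → IsNonLoopIAS G K y → IsNonLoopIAS G K z →
    (∀ u → K u ≡ true → colSum G (single y) u ≡ colSum G (single z) u) →
    LoopAndParallelPair G K
  loopAndParallelPair {x} {y} {z} x≢y x≢z y≢z cover loop ny nz same =
    x , y , z , x≢y , x≢z , y≢z , cover , loop , ny , nz , yz ,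
    loop-isolated loop x≢y , loop-isolated loop x≢z ,
    inj₂ (pair y z , yz , pair-∋ˡ y z , pair-∋ʳ y z)
    where
    yz : CircuitIAS G K (pair y z)
    yz = parallel-circuit y≢z ny nz same

module _ {n} {G : LoopedSimpleGraph n} where

  reachable-trans : ∀ {u v w} → Reachable G u v → Reachable G v w → Reachable G u w
  reachable-trans here         r = r
  reachable-trans (step uv r′) r = step uv (reachable-trans r′ r)

  reachable-sym : ∀ {u v} → Reachable G u v → Reachable G v u
  reachable-sym here                    = here
  reachable-sym {u} (step {w = w} uw r) =
    reachable-trans (reachable-sym r) (step (trans (adj-sym G w u) uw) here)

  walk⇒neighbour : ∀ {v y} → Reachable G v y → y ≢ v → ∃[ w ] (adj G v w ≡ true × w ≢ v)
  walk⇒neighbour here y≢v = ⊥-elim (y≢v refl)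
  walk⇒neighbour {v} (step {w = w} vw r) y≢v with w ≟F v
  ... | yes refl = walk⇒neighbour r y≢v
  ... | no w≢v   = w , vw , w≢v

  component-closed : ∀ {K u v} → IsComponent G K → K u ≡ true → adj G u v ≡ true → K v ≡ true
  component-closed {u = u} {v} (_ , K⇔reach) Ku uv =
    Equivalence.from (K⇔reach u v Ku) (step uv here)

  component-apart : ∀ {K u v} → IsComponent G K → K u ≢ K v → u ≢ v × adj G u v ≡ false
  component-apart {K} {u} {v} comp Ku≢Kv = Ku≢Kv ∘ cong K , ¬-not (Ku≢Kv ∘ same-side)
    where
    same-side : adj G u v ≡ true → K u ≡ K v
    same-side uv with K u in Ku
    ... | true  = sym (component-closed comp Ku uv)
    ... | false = sym (¬-not λ Kv →
      ≡true⇒≢false (component-closed comp Kv (trans (adj-sym G v u) uv)) Ku)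

reachable-component : ∀ {n} {G : LoopedSimpleGraph n} {v}
  (reach? : ∀ x → Dec (Reachable G v x)) → IsComponent G (λ x → ⌊ reach? x ⌋)
reachable-component {v = v} reach? =
  (v , from (⌊⌋⇔ (reach? v)) here) , λ u w Ku → mk⇔
    (λ Kw → reachable-trans (reachable-sym (to (⌊⌋⇔ (reach? u)) Ku)) (to (⌊⌋⇔ (reach? w)) Kw))
    (λ uw → from (⌊⌋⇔ (reach? w)) (reachable-trans (to (⌊⌋⇔ (reach? u)) Ku) uw))
  where open Equivalence

¬¬-decidable : ∀ {n} (P : Fin n → Set) → ¬ ¬ (∀ x → Dec (P x))
¬¬-decidable {zero}  P k = k λ ()
¬¬-decidable {suc n} P k = ¬¬-excluded-middle λ P₀? →
  ¬¬-decidable (P ∘ suc) λ Pₛ? → k λ { zero → P₀? ; (suc i) → Pₛ? i }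

card-false : ∀ {n} (K : VSet n) → (∀ y → K y ≡ false) → card K ≡ 0
card-false {zero}  K none = refl
card-false {suc n} K none rewrite none zero = card-false (K ∘ suc) (none ∘ suc)

card-singleton : ∀ {n} (K : VSet n) v → K v ≡ true → (∀ y → K y ≡ true → y ≡ v) → card K ≡ 1
card-singleton {suc n} K zero Kv only rewrite Kv =
  cong suc (card-false (K ∘ suc) λ i → ¬-not λ Ki → 0≢1+n (sym (only (suc i) Ki)))
card-singleton {suc n} K (suc v) Kv only with K zero in K₀
... | true  = ⊥-elim (0≢1+n (only zero K₀))
... | false = card-singleton (K ∘ suc) v Kv λ y Ky → suc-injective (only (suc y) Ky)

1≤card : ∀ {n} (K : VSet n) a → K a ≡ true → 1 ≤ card K
1≤card K zero    Ka rewrite Ka = s≤s z≤n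
1≤card K (suc a) Ka = ≤-trans (1≤card (K ∘ suc) a Ka) (m≤n+m _ _)

2≤card : ∀ {n} (K : VSet n) a b → K a ≡ true → K b ≡ true → a ≢ b → 2 ≤ card K
2≤card K zero    zero    Ka Kb a≢b = ⊥-elim (a≢b refl)
2≤card K zero    (suc b) Ka Kb a≢b rewrite Ka = s≤s (1≤card (K ∘ suc) b Kb)
2≤card K (suc a) zero    Ka Kb a≢b rewrite Kb = s≤s (1≤card (K ∘ suc) a Ka)
2≤card K (suc a) (suc b) Ka Kb a≢b =
  ≤-trans (2≤card (K ∘ suc) a b Ka Kb (a≢b ∘ cong suc)) (m≤n+m _ _)

card≢1⇒another : ∀ {n} (K : VSet n) {v} → card K ≢ 1 → K v ≡ true →
  ∃[ y ] (K y ≡ true × y ≢ v)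
card≢1⇒another K {v} card≢1 Kv with any? (λ y → (K y ≟ true) ×-dec ¬? (y ≟F v))
... | yes (y , Ky , y≢v) = y , Ky , y≢v
... | no ∄y = ⊥-elim (card≢1 (card-singleton K v Kv λ y Ky →
  decidable-stable (y ≟F v) λ y≢v → ∄y (y , Ky , y≢v)))

card≡1⇒singleton : ∀ {n} (K : VSet n) {v} → card K ≡ 1 → K v ≡ true →
  ∀ y → K y ≡ true → y ≡ v
card≡1⇒singleton K {v} card≡1 Kv y Ky = decidable-stable (y ≟F v) λ y≢v →
  case subst (2 ≤_) card≡1 (2≤card K y v Ky Kv y≢v) of λ { (s≤s ()) }

-- The direct sum

module _ {n} (G : LoopedSimpleGraph n) where

  module _ {K : VSet n} (comp : IsComponent G K) where

    isCycle-everywhere : ∀ {T} → T ⊆ WOf K → IsCycle G K T → IsCycle G allV T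
    isCycle-everywhere {T} T⊆K cyc u _ with K u in Ku
    ... | true  = cyc u Ku
    ... | false = colSum-apart G T u λ v k Tvk →
      component-apart comp λ Ku≡Kv → ≡true⇒≢false (trans Ku≡Kv (T⊆K (v , k) Tvk)) Ku

    isCycle-componentPart : ∀ {T} → IsCycle G allV T → IsCycle G K (T ∩ WOf K)
    isCycle-componentPart {T} cyc u Ku = begin
      colSum G (T ∩ WOf K) u  ≡⟨ xor≡false⇒≡ (begin
          colSum G (T ∩ WOf K) u xor colSum G (T − WOf K) u
            ≡⟨ colSum-Δ G (T ∩ WOf K) (T − WOf K) u ⟨
          colSum G ((T ∩ WOf K) Δ (T − WOf K)) u
            ≡⟨ colSum-cong G (∩Δ− T (WOf K)) u ⟨
          colSum G T u
            ≡⟨ cyc u refl ⟩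
          false ∎) ⟩
      colSum G (T − WOf K) u  ≡⟨ colSum-apart G (T − WOf K) u outside ⟩
      false                   ∎
      where
      open ≡-Reasoning
      outside : ∀ v k → (T − WOf K) (v , k) ≡ true → u ≢ v × adj G u v ≡ false
      outside v k h = component-apart comp λ Ku≡Kv →
        ≡true⇒≢false (trans (sym Ku≡Kv) Ku) (not-injective (∧-conicalʳ _ _ h))

  independent⇔componentwise : ∀ S →
    IndepIAS G allV S ⇔ (∀ K → IsComponent G K → IndepIAS G K (S ∩W K))
  independent⇔componentwise S = mk⇔ restrict assemble
    where
    restrict : IndepIAS G allV S → ∀ K → IsComponent G K → IndepIAS G K (S ∩W K)
    restrict (_ , indep) K comp = ∩-⊆ʳ , λ (T , T⊆S∩K , ne , cyc) →
      indep (T , ⊆-trans T⊆S∩K ∩-⊆ˡ , ne , isCycle-everywhere comp (⊆-trans T⊆S∩K ∩-⊆ʳ) cyc)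

    -- Reachability from v₀ is only decidable up to double negation; the goal is a negation.
    assemble : (∀ K → IsComponent G K → IndepIAS G K (S ∩W K)) → IndepIAS G allV S
    assemble indep = (λ _ _ → refl) , λ (T , T⊆S , ((v₀ , k₀) , Te₀) , cyc) →
      ¬¬-decidable (Reachable G v₀) λ reach? →
        let K    = λ x → ⌊ reach? x ⌋
            comp = reachable-component reach?
            Kv₀  = Equivalence.from (⌊⌋⇔ (reach? v₀)) here
        in proj₂ (indep K comp) (T ∩ WOf K , ∩-monoˡ T⊆S , ((v₀ , k₀) , cong₂ _∧_ Te₀ Kv₀) ,
                                 isCycle-componentPart comp {T} cyc)

-- Components with one vertex

-- The row of a single vertex v in (I | A | I + A), with ℓ = 1 iff v carries a loop.
vertexRow : ColKind → Bool → Bool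
vertexRow φ ℓ = true
vertexRow χ ℓ = ℓ
vertexRow ψ ℓ = not ℓ

module _ {n} (G : LoopedSimpleGraph n) (K : VSet n) (v : Fin n)
         (Kv : K v ≡ true) (only-v : ∀ y → K y ≡ true → y ≡ v) where

  colSum-single-row : ∀ k → colSum G (single (v , k)) v ≡ vertexRow k (adj G v v)
  colSum-single-row k = begin
    colSum G (single (v , k)) v
      ≡⟨ colSum-supportedAt G (single (v , k)) v (λ w l h → sym (cong proj₁ (eqW⇒≡ _ _ h))) v ⟩
    columnsAt G (single (v , k)) v v
      ≡⟨ columnsAt-diagonal G (single (v , k)) v ⟩
    _
      ≡⟨ row k ⟩
    vertexRow k (adj G v v)
      ∎
    where
    open ≡-Reasoning
    row : ∀ k → (single (v , k) (v , φ) xor single (v , k) (v , ψ))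
                  xor ((single (v , k) (v , χ) xor single (v , k) (v , ψ)) ∧ adj G v v)
                ≡ vertexRow k (adj G v v)
    row φ rewrite ⌊≟⌋-refl v = refl
    row χ rewrite ⌊≟⌋-refl v = refl
    row ψ rewrite ⌊≟⌋-refl v = refl

  isCycle-row : ∀ {T} → colSum G T v ≡ false → IsCycle G K T
  isCycle-row row≡0 u Ku rewrite only-v u Ku = row≡0

  loopAndParallelPair-kinds : ∀ {o p q} → (∀ k → k ≡ o ⊎ k ≡ p ⊎ k ≡ q) →
    o ≢ p → o ≢ q → p ≢ q → vertexRow o (adj G v v) ≡ false →
    vertexRow p (adj G v v) ≡ true → vertexRow q (adj G v v) ≡ true → LoopAndParallelPair G K
  loopAndParallelPair-kinds {o} {p} {q} kinds o≢p o≢q p≢q o₀ p₁ q₁ =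
    loopAndParallelPair G K (o≢p ∘ cong proj₂) (o≢q ∘ cong proj₂) (p≢q ∘ cong proj₂) cover
      (isLoop-intro G K Kv (isCycle-row {single (v , o)} (trans (colSum-single-row o) o₀)))
      (isNonLoop-intro G K Kv v Kv (trans (colSum-single-row p) p₁))
      (isNonLoop-intro G K Kv v Kv (trans (colSum-single-row q) q₁))
      parallel
    where
    parallel : ∀ u → K u ≡ true → colSum G (single (v , p)) u ≡ colSum G (single (v , q)) u
    parallel u Ku rewrite only-v u Ku =
      trans (colSum-single-row p) (trans p₁ (sym (trans (colSum-single-row q) q₁)))
    cover : ∀ e → WOf K e ≡ true → e ≡ (v , o) ⊎ e ≡ (v , p) ⊎ e ≡ (v , q)
    cover (w , k) Kw rewrite only-v w Kw with kinds k
    ... | inj₁ refl        = inj₁ refl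
    ... | inj₂ (inj₁ refl) = inj₂ (inj₁ refl)
    ... | inj₂ (inj₂ refl) = inj₂ (inj₂ refl)

  singleVertex-loopAndParallelPair : LoopAndParallelPair G K
  singleVertex-loopAndParallelPair with adj G v v in ℓ
  ... | true  = loopAndParallelPair-kinds
    (λ { φ → inj₂ (inj₁ refl) ; χ → inj₂ (inj₂ refl) ; ψ → inj₁ refl }) (λ ()) (λ ()) (λ ())
    (cong not ℓ) refl ℓ
  ... | false = loopAndParallelPair-kinds
    (λ { φ → inj₂ (inj₁ refl) ; χ → inj₁ refl ; ψ → inj₂ (inj₂ refl) }) (λ ()) (λ ()) (λ ())
    ℓ refl (cong not ℓ)

-- Components with several vertices

vertexTriple : ∀ {n} → Fin n → WSet n
vertexTriple v (w , k) = ⌊ w ≟F v ⌋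

-- Column w of A is the sum of the columns of I at the neighbours of w.
star : ∀ {n} → LoopedSimpleGraph n → Fin n → WSet n
star G w (x , φ) = adj G x w
star G w (x , χ) = ⌊ x ≟F w ⌋
star G w (x , ψ) = false

module _ {n} (G : LoopedSimpleGraph n) where

  colSum-φχ : ∀ T w → (∀ x → T (x , ψ) ≡ false) → (∀ x → x ≢ w → T (x , χ) ≡ false) →
    ∀ u → colSum G T u ≡ T (u , φ) xor (T (w , χ) ∧ adj G u w)
  colSum-φχ T w noψ χ-at-w u = begin
    colSum G T u
      ≡⟨ xorSum-cong (λ x → xor-identityʳ′ (noψ x)) ⟩
    xorSum (λ x → f x xor g x)
      ≡⟨ xorSum-xor f g ⟩
    xorSum f xor xorSum g
      ≡⟨ cong₂ _xor_ (xorSum-single f u f-at-u) (xorSum-single g w g-at-w) ⟩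
    f u xor g w
      ≡⟨ cong (λ b → (T (u , φ) ∧ b) xor g w) (⌊≟⌋-refl u) ⟩
    (T (u , φ) ∧ true) xor g w
      ≡⟨ cong (_xor g w) (∧-identityʳ (T (u , φ))) ⟩
    T (u , φ) xor g w
      ∎
    where
    open ≡-Reasoning
    f g : Fin n → Bool
    f x = T (x , φ) ∧ ⌊ u ≟F x ⌋
    g x = T (x , χ) ∧ adj G u x
    xor-identityʳ′ : ∀ {a c} → a ≡ false → ∀ {b} → b xor (a ∧ c) ≡ b
    xor-identityʳ′ refl = xor-identityʳ _
    f-at-u : ∀ x → x ≢ u → f x ≡ false
    f-at-u x x≢u rewrite ⌊≟⌋-≢ (x≢u ∘ sym) = ∧-zeroʳ _
    g-at-w : ∀ x → x ≢ w → g x ≡ false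
    g-at-w x x≢w rewrite χ-at-w x x≢w = refl

  module _ {K : VSet n} (comp : IsComponent G K) where

    vertexTriple-circuit : ∀ {v w} → K v ≡ true → adj G v w ≡ true → w ≢ v →
      CircuitIAS G K (vertexTriple v)
    vertexTriple-circuit {v} {w} Kv vw w≢v =
      circuit-intro G K triple⊆K ((v , φ) , ⌊≟⌋-refl v) cyc minimal
      where
      at-v : ∀ {T} → T ⊆ vertexTriple v → ∀ x k → T (x , k) ≡ true → x ≡ v
      at-v T⊆ x k Txk = ⌊≟⌋⇒≡ (T⊆ (x , k) Txk)
      triple⊆K : vertexTriple v ⊆ WOf K
      triple⊆K (x , k) h rewrite ⌊≟⌋⇒≡ h = Kv
      -- columns v_φ + v_χ = v_ψ
      columns-cancel : ∀ u → columnsAt G (vertexTriple v) u v ≡ false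
      columns-cancel u rewrite ⌊≟⌋-refl v = xor-same (⌊ u ≟F v ⌋ xor adj G u v)
      cyc : IsCycle G K (vertexTriple v)
      cyc u _ = trans (colSum-supportedAt G (vertexTriple v) v (at-v ⊆-refl) u) (columns-cancel u)
      minimal : ∀ {T} → T ⊆ vertexTriple v → NonEmpty T → IsCycle G K T → vertexTriple v ⊆ T
      minimal {T} T⊆ ((y , l) , Tyl) cycT (x , k) h rewrite ⌊≟⌋⇒≡ h =
        trans (uniform k) (trans (sym (uniform l)) Tvl)
        where
        row : ∀ u → K u ≡ true → columnsAt G T u v ≡ false
        row u Ku = trans (sym (colSum-supportedAt G T v (at-v T⊆) u)) (cycT u Ku)
        χ+ψ≡0 : T (v , χ) xor T (v , ψ) ≡ false
        χ+ψ≡0 = begin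
          T (v , χ) xor T (v , ψ)                    ≡⟨ ∧-identityʳ _ ⟨
          (T (v , χ) xor T (v , ψ)) ∧ true           ≡⟨ cong (_ ∧_) (trans (adj-sym G w v) vw) ⟨
          (T (v , χ) xor T (v , ψ)) ∧ adj G w v      ≡⟨ columnsAt-offDiagonal G T w≢v ⟨
          columnsAt G T w v                          ≡⟨ row w (component-closed comp Kv vw) ⟩
          false                                      ∎
          where open ≡-Reasoning
        φ+ψ≡0 : T (v , φ) xor T (v , ψ) ≡ false
        φ+ψ≡0 = begin
          T (v , φ) xor T (v , ψ)
            ≡⟨ xor-identityʳ _ ⟨
          (T (v , φ) xor T (v , ψ)) xor (false ∧ adj G v v)
            ≡⟨ cong (λ b → (T (v , φ) xor T (v , ψ)) xor (b ∧ adj G v v)) χ+ψ≡0 ⟨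
          (T (v , φ) xor T (v , ψ)) xor ((T (v , χ) xor T (v , ψ)) ∧ adj G v v)
            ≡⟨ columnsAt-diagonal G T v ⟨
          columnsAt G T v v
            ≡⟨ row v Kv ⟩
          false
            ∎
          where open ≡-Reasoning
        uniform : ∀ k → T (v , k) ≡ T (v , ψ)
        uniform φ = xor≡false⇒≡ φ+ψ≡0
        uniform χ = xor≡false⇒≡ χ+ψ≡0
        uniform ψ = refl
        Tvl : T (v , l) ≡ true
        Tvl = subst (λ z → T (z , l) ≡ true) (at-v T⊆ y l Tyl) Tyl

    star-circuit : ∀ {w} → K w ≡ true → CircuitIAS G K (star G w)
    star-circuit {w} Kw = circuit-intro G K star⊆K ((w , χ) , ⌊≟⌋-refl w) cyc minimal
      where
      star⊆K : star G w ⊆ WOf K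
      star⊆K (x , φ) h = component-closed comp Kw (trans (adj-sym G w x) h)
      star⊆K (x , χ) h rewrite ⌊≟⌋⇒≡ h = Kw
      rows : ∀ {T} → T ⊆ star G w → ∀ u → colSum G T u ≡ T (u , φ) xor (T (w , χ) ∧ adj G u w)
      rows {T} T⊆ = colSum-φχ T w (λ x → ⊆-false T⊆ (x , ψ) refl)
                              (λ x x≢w → ⊆-false T⊆ (x , χ) (⌊≟⌋-≢ x≢w))
      cyc : IsCycle G K (star G w)
      cyc u _ rewrite rows ⊆-refl u | ⌊≟⌋-refl w = xor-same (adj G u w)
      minimal : ∀ {T} → T ⊆ star G w → NonEmpty T → IsCycle G K T → star G w ⊆ T
      minimal {T} T⊆ (e , Te) cycT = star⊆T (T (w , χ)) refl
        where
        φ-rows : ∀ u → K u ≡ true → T (u , φ) ≡ T (w , χ) ∧ adj G u w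
        φ-rows u Ku = xor≡false⇒≡ (trans (sym (rows T⊆ u)) (cycT u Ku))
        K-of-φ : ∀ {x} → T (x , φ) ≡ true → K x ≡ true
        K-of-φ {x} Txφ = star⊆K (x , φ) (T⊆ (x , φ) Txφ)
        χ-absent : T (w , χ) ≡ false → ∀ e → T e ≡ false
        χ-absent Twχ (x , φ) = ¬-not λ Txφ →
          ≡true⇒≢false Txφ (trans (φ-rows x (K-of-φ Txφ)) (cong (_∧ adj G x w) Twχ))
        χ-absent Twχ (x , χ) with x ≟F w
        ... | yes refl = Twχ
        ... | no x≢w   = ⊆-false T⊆ (x , χ) (⌊≟⌋-≢ x≢w)
        χ-absent Twχ (x , ψ) = ⊆-false T⊆ (x , ψ) refl
        star⊆T : ∀ b → T (w , χ) ≡ b → star G w ⊆ T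
        star⊆T false Twχ = ⊥-elim (≡true⇒≢false Te (χ-absent Twχ e))
        star⊆T true  Twχ (x , φ) h = trans (φ-rows x (star⊆K (x , φ) h)) (cong₂ _∧_ Twχ h)
        star⊆T true  Twχ (x , χ) h rewrite ⌊≟⌋⇒≡ h = Twχ

    kinds-linked : ∀ {v w} → K v ≡ true → adj G v w ≡ true → w ≢ v →
      ∀ k l → ConnRelIAS G K (v , k) (v , l)
    kinds-linked {v} Kv vw w≢v k l =
      inj₂ (vertexTriple v , vertexTriple-circuit Kv vw w≢v , ⌊≟⌋-refl v , ⌊≟⌋-refl v)

    -- Along an edge v — w: v_φ and w_χ share the star of w, and w_χ, w_φ share the triple of w.
    φ-linked : ∀ {v x} → K v ≡ true → Reachable G v x → ConnRelIAS G K (v , φ) (x , φ)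
    φ-linked Kv here = inj₁ refl
    φ-linked {v} Kv (step {w = w} vw r) with v ≟F w
    ... | yes refl = φ-linked Kv r
    ... | no v≢w   =
      connRel-trans G K (inj₂ (star G w , star-circuit Kw , vw , ⌊≟⌋-refl w))
        (connRel-trans G K (kinds-linked Kw (trans (adj-sym G w v) vw) v≢w χ φ) (φ-linked Kw r))
      where
      Kw : K w ≡ true
      Kw = component-closed comp Kv vw

    component-neighbour : card K ≢ 1 → ∀ {u} → K u ≡ true → ∃[ w ] (adj G u w ≡ true × w ≢ u)
    component-neighbour card≢1 {u} Ku with card≢1⇒another K card≢1 Ku
    ... | y , Ky , y≢u = walk⇒neighbour (Equivalence.to (proj₂ comp u y Ku) Ky) y≢u

    component-connected : card K ≢ 1 → IsConnectedIAS G K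
    component-connected card≢1 (v , k) (x , l) Kv Kx e≢f
      with component-neighbour card≢1 Kv | component-neighbour card≢1 Kx
    ... | _ , vw , w≢v | _ , xw′ , w′≢x =
      [ ⊥-elim ∘ e≢f , id ]′
        (connRel-trans G K (kinds-linked Kv vw w≢v k φ)
          (connRel-trans G K (φ-linked Kv (Equivalence.to (proj₂ comp v x Kv) Kx))
            (kinds-linked Kx xw′ w′≢x φ l)))

theorem34 : ∀ {n} (G : LoopedSimpleGraph n) →
    (∀ (S : WSet n) →
      IndepIAS G allV S ⇔ (∀ K → IsComponent G K → IndepIAS G K (S ∩W K)))
    × (∀ K → IsComponent G K →
        (card K ≢ 1 → IsConnectedIAS G K) × (card K ≡ 1 → LoopAndParallelPair G K))
theorem34 G = independent⇔componentwise G , λ K comp →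
  component-connected G comp ,
  λ card≡1 → let (v , Kv) = proj₁ comp in
    singleVertex-loopAndParallelPair G K v Kv (card≡1⇒singleton K card≡1 Kv)
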